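{- Let $i$ be a positive integer and $D$ a nontrivial weakly connected $(i,1)$ digraph. Then the set of all maximal cliques of $P(D)$ is exactly $\{N_D^-[u] : u\in V(D),\ d_D^-(u)\ge 1\}$.
   Context: All digraphs are finite and simple. An $(i,1)$ digraph is an acyclic digraph in which every vertex has indegree at most $i$ and outdegree at most $1$. Weakly connected means the underlying graph is connected; nontrivial means at least two vertices. For an acyclic digraph $D$, the phylogeny graph $P(D)$ has vertex set $V(D)$, with $u\ne v$ adjacent iff $(u,v)\in A(D)$, or $(v,u)\in A(D)$, or $u$ and $v$ have a common out-neighbor in $D$. $d_D^-(u)$ is the indegree of $u$ and $N_D^-[u]$ is $\{u\}$ together with the set of in-neighbors of $u$ in $D$. -}

module Defs where

open import Data.Nat using (ℕ; _≤_)
open import Data.Fin using (Fin)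
open import Data.Fin.Properties using (_≟_)
open import Data.Fin.Subset using (Subset; _∈_; _⊆_; ∣_∣)
open import Data.Vec using (tabulate)
open import Data.Bool using (Bool; true; false; _∨_)
open import Data.Product using (Σ; _×_)
open import Data.Sum using (_⊎_)
open import Relation.Nullary using (¬_)
open import Relation.Nullary.Decidable using (⌊_⌋)
open import Relation.Binary.PropositionalEquality using (_≡_; _≢_)
open import Relation.Binary.Construct.Closure.ReflexiveTransitive using (Star)

-- A finite simple digraph on vertex set Fin n, given by a Boolean arc
-- relation (arc u v ≡ true  iff  (u,v) is an arc), with no loops.
-- Simplicity (no multiple arcs) is automatic for a relation.
record Digraph : Set where
  field
    n        : ℕ
    arc      : Fin n → Fin n → Bool
    loopless : ∀ v → arc v v ≡ false
open Digraph public

module _ (D : Digraph) where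

  Arc : Fin (n D) → Fin (n D) → Set
  Arc u v = arc D u v ≡ true

  data DPath : Fin (n D) → Fin (n D) → Set where
    single : ∀ {u v} → Arc u v → DPath u v
    cons   : ∀ {u w v} → Arc u w → DPath w v → DPath u v

  Acyclic : Set
  Acyclic = ∀ v → ¬ DPath v v

  InN : Fin (n D) → Subset (n D)
  InN v = tabulate (λ u → arc D u v)

  OutN : Fin (n D) → Subset (n D)
  OutN u = tabulate (λ v → arc D u v)

  indeg : Fin (n D) → ℕ
  indeg v = ∣ InN v ∣

  outdeg : Fin (n D) → ℕ
  outdeg u = ∣ OutN u ∣

  ClosedInN : Fin (n D) → Subset (n D)
  ClosedInN u = tabulate (λ w → ⌊ w ≟ u ⌋ ∨ arc D w u)

  Is-i1 : ℕ → Set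
  Is-i1 i = Acyclic × (∀ v → indeg v ≤ i) × (∀ v → outdeg v ≤ 1)

  UAdj : Fin (n D) → Fin (n D) → Set
  UAdj u v = Arc u v ⊎ Arc v u

  WeaklyConnected : Set
  WeaklyConnected = ∀ u v → Star UAdj u v

  PAdj : Fin (n D) → Fin (n D) → Set
  PAdj u v = u ≢ v × (Arc u v ⊎ Arc v u ⊎ Σ (Fin (n D)) (λ w → Arc u w × Arc v w))

  IsClique : Subset (n D) → Set
  IsClique S = ∀ u v → u ∈ S → v ∈ S → u ≢ v → PAdj u v

  IsMaximalClique : Subset (n D) → Set
  IsMaximalClique S = IsClique S × (∀ T → IsClique T → S ⊆ T → T ⊆ S)

module Submission where

-- In an acyclic digraph D with outdegree ≤ 1 every vertex has at
-- most one out-neighbour, and D has no loops, 2-cycles or 3-cycles.  From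
-- this we read off the shape of the cliques of the phylogeny graph P(D):
--
--   * N⁻[u] is always a clique of P(D) (u is joined to its in-neighbours, and
--     two in-neighbours of u share the out-neighbour u);
--   * a clique containing an arc a → b lies inside N⁻[b];
--   * a clique containing no arc, but a vertex x with x → w, lies inside N⁻[w];
--   * a clique with at most one vertex lies inside N⁻[u] for a suitable u,
--     provided every vertex has a neighbour in the underlying graph (which
--     weak connectivity on ≥ 2 vertices guarantees).
--
-- Hence every clique lies in some N⁻[u] with d⁻(u) ≥ 1, so a maximal clique
-- equals such an N⁻[u]; conversely, for d⁻(u) ≥ 1 the set N⁻[u] contains an
-- arc w → u, so every clique containing it lies in N⁻[u]: it is maximal.

open import Defs
open import Data.Nat using (ℕ; _≤_; suc; s≤s)
open import Data.Nat.Properties using (≤-<-trans)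
open import Data.Fin using (Fin) renaming (zero to fzero; suc to fsuc)
open import Data.Fin.Properties using (_≟_; any?)
open import Data.Fin.Subset using (Subset; _∈_; _⊆_; ∣_∣; Nonempty)
open import Data.Fin.Subset.Properties
  using (⊆-antisym; _∈?_; nonempty?; Empty-unique; ∣⊥∣≡0; ∣⁅x⁆∣≡1; x∈⁅y⁆⇒x≡y;
         p⊆q⇒∣p∣≤∣q∣; p⊂q⇒∣p∣<∣q∣; x∈p⇒p-x⊂p; x∈p∧x≢y⇒x∈p-y)
open import Data.Vec using (tabulate)
open import Data.Vec.Properties using ([]=⇒lookup; lookup⇒[]=; lookup∘tabulate)
open import Data.Bool using (Bool; true; _∨_)
import Data.Bool as Bool
open import Data.Product using (Σ; ∃; _×_; _,_; proj₂)
open import Data.Sum using (_⊎_; inj₁; inj₂)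
open import Data.Empty using (⊥-elim)
open import Relation.Nullary using (¬_; Dec; yes; no; ¬?; _×-dec_)
open import Relation.Nullary.Decidable using (⌊_⌋)
open import Relation.Binary.PropositionalEquality using (_≡_; _≢_; refl; sym; trans; subst)
open import Relation.Binary.Construct.Closure.ReflexiveTransitive using (ε; _◅_)

∈-tabulate⁻ : ∀ {m} (f : Fin m → Bool) x → x ∈ tabulate f → f x ≡ true
∈-tabulate⁻ f x x∈ = trans (sym (lookup∘tabulate f x)) ([]=⇒lookup x∈)

∈-tabulate⁺ : ∀ {m} (f : Fin m → Bool) x → f x ≡ true → x ∈ tabulate f
∈-tabulate⁺ f x fx = lookup⇒[]= x (tabulate f) (trans (lookup∘tabulate f x) fx)

member⇒positive : ∀ {m} {x : Fin m} {p : Subset m} → x ∈ p → 1 ≤ ∣ p ∣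
member⇒positive {x = x} {p} x∈p =
  subst (_≤ ∣ p ∣) (∣⁅x⁆∣≡1 x)
        (p⊆q⇒∣p∣≤∣q∣ (λ y∈⁅x⁆ → subst (_∈ p) (sym (x∈⁅y⁆⇒x≡y x y∈⁅x⁆)) x∈p))

-- A subset with two distinct members has size ≥ 2 (y ∈ p - x ⊂ p).
distinct-members⇒size≥2 : ∀ {m} {x y : Fin m} {p : Subset m} →
                          x ∈ p → y ∈ p → y ≢ x → 2 ≤ ∣ p ∣
distinct-members⇒size≥2 x∈p y∈p y≢x =
  ≤-<-trans (member⇒positive (x∈p∧x≢y⇒x∈p-y y∈p y≢x)) (p⊂q⇒∣p∣<∣q∣ (x∈p⇒p-x⊂p x∈p))

positive⇒member : ∀ {m} (p : Subset m) → 1 ≤ ∣ p ∣ → Nonempty p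
positive⇒member {m} p size≥1 with nonempty? p
... | yes ne = ne
... | no empty with subst (λ q → 1 ≤ ∣ q ∣) (Empty-unique empty) size≥1
...   | size⊥≥1 with subst (1 ≤_) (∣⊥∣≡0 m) size⊥≥1
...     | ()

some-element : ∀ {k} → 2 ≤ k → Fin k
some-element (s≤s _) = fzero

other-element : ∀ {k} → 2 ≤ k → (x : Fin k) → ∃ λ y → y ≢ x
other-element {suc (suc k)} (s≤s (s≤s _)) fzero    = fsuc fzero , λ ()
other-element {suc (suc k)} (s≤s (s≤s _)) (fsuc x) = fzero , λ ()

module _ (D : Digraph) where

  private
    V = Fin (n D)

  ∈N⁻⁺ : ∀ {z u} → z ≡ u ⊎ Arc D z u → z ∈ ClosedInN D u
  ∈N⁻⁺ {z} {u} h = ∈-tabulate⁺ _ z (characteristic h)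
    where
    characteristic : z ≡ u ⊎ Arc D z u → (⌊ z ≟ u ⌋ ∨ arc D z u) ≡ true
    characteristic h with z ≟ u
    characteristic h         | yes _  = refl
    characteristic (inj₁ e)  | no z≢u = ⊥-elim (z≢u e)
    characteristic (inj₂ zu) | no _   = zu

  ∈N⁻⁻ : ∀ {z u} → z ∈ ClosedInN D u → z ≡ u ⊎ Arc D z u
  ∈N⁻⁻ {z} {u} z∈ with z ≟ u | ∈-tabulate⁻ _ z z∈
  ... | yes e | _  = inj₁ e
  ... | no _  | zu = inj₂ zu

  arc⇒indeg≥1 : ∀ {w u} → Arc D w u → 1 ≤ indeg D u
  arc⇒indeg≥1 {w} wu = member⇒positive (∈-tabulate⁺ _ w wu)

  -- N⁻[u] is a clique of P(D): u is adjacent to its in-neighbours, and two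
  -- in-neighbours of u have the common out-neighbour u.
  closedInN-clique : ∀ u → IsClique D (ClosedInN D u)
  closedInN-clique u a b a∈ b∈ a≢b with ∈N⁻⁻ a∈ | ∈N⁻⁻ b∈
  ... | inj₁ refl | inj₁ refl = ⊥-elim (a≢b refl)
  ... | inj₁ refl | inj₂ bu   = a≢b , inj₂ (inj₁ bu)
  ... | inj₂ au   | inj₁ refl = a≢b , inj₁ au
  ... | inj₂ au   | inj₂ bu   = a≢b , inj₂ (inj₂ (u , au , bu))

  Covered : V → Set
  Covered x = Σ V λ u → 1 ≤ indeg D u × x ∈ ClosedInN D u

  -- In a weakly connected digraph on ≥ 2 vertices, x has a neighbour v in the
  -- underlying graph (first step of a walk to another vertex); then x lies in
  -- N⁻[v] if x → v, and in N⁻[x] if v → x.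
  weakly-connected⇒covered : 2 ≤ n D → WeaklyConnected D → ∀ x → Covered x
  weakly-connected⇒covered two≤n wc x with other-element two≤n x
  ... | y , y≢x with wc x y
  ...   | ε           = ⊥-elim (y≢x refl)
  ...   | inj₁ xv ◅ _ = _ , arc⇒indeg≥1 xv , ∈N⁻⁺ (inj₂ xv)
  ...   | inj₂ vx ◅ _ = _ , arc⇒indeg≥1 vx , ∈N⁻⁺ (inj₁ refl)

-- Acyclic digraphs with outdegree at most one: here the out-neighbour relation
-- is a partial function, which pins down the cliques of P(D).

module Functional (D : Digraph) (acyclic : Acyclic D)
                  (outdeg≤1 : ∀ v → outdeg D v ≤ 1) where

  private
    V = Fin (n D)

  out-unique : ∀ {x a b} → Arc D x a → Arc D x b → a ≡ b
  out-unique {x} {a} {b} xa xb with a ≟ b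
  ... | yes a≡b = a≡b
  ... | no a≢b
    with distinct-members⇒size≥2 (∈-tabulate⁺ _ b xb) (∈-tabulate⁺ _ a xa) a≢b
  ...   | size≥2 with ≤-<-trans size≥2 (s≤s (outdeg≤1 x))
  ...     | s≤s (s≤s ())

  no-loop : ∀ {a} → ¬ Arc D a a
  no-loop aa = acyclic _ (single aa)

  no-2-cycle : ∀ {a b} → Arc D a b → ¬ Arc D b a
  no-2-cycle ab ba = acyclic _ (cons ab (single ba))

  no-3-cycle : ∀ {a b c} → Arc D a b → Arc D b c → ¬ Arc D c a
  no-3-cycle ab bc ca = acyclic _ (cons ab (cons bc (single ca)))

  path-ends-nonadjacent : ∀ {z a b} → Arc D z a → Arc D a b → ¬ PAdj D z b
  path-ends-nonadjacent za ab (_ , inj₁ zb) with out-unique za zb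
  ... | refl = no-loop ab
  path-ends-nonadjacent za ab (_ , inj₂ (inj₁ bz)) = no-3-cycle ab bz za
  path-ends-nonadjacent za ab (_ , inj₂ (inj₂ (w , zw , bw))) with out-unique za zw
  ... | refl = no-2-cycle ab bw

  clique-with-arc⊆N⁻ : ∀ S → IsClique D S → ∀ {a b} → Arc D a b → a ∈ S → b ∈ S →
                       S ⊆ ClosedInN D b
  clique-with-arc⊆N⁻ S clique {a} {b} ab a∈ b∈ {z} z∈ = ∈N⁻⁺ D (position z∈)
    where
    position : z ∈ S → z ≡ b ⊎ Arc D z b
    position z∈ with z ≟ a
    ... | yes refl = inj₂ ab
    ... | no z≢a with proj₂ (clique z a z∈ a∈ z≢a)
    ...   | inj₂ (inj₁ az) = inj₁ (out-unique az ab)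
    ...   | inj₂ (inj₂ (w , zw , aw)) = inj₂ (subst (Arc D z) (out-unique aw ab) zw)
    ...   | inj₁ za with z ≟ b
    ...     | yes z≡b = inj₁ z≡b
    ...     | no z≢b  = ⊥-elim (path-ends-nonadjacent za ab (clique z b z∈ b∈ z≢b))

  SpansArc : Subset (n D) → Set
  SpansArc S = ∃ λ a → ∃ λ b → a ∈ S × b ∈ S × Arc D a b

  spansArc? : ∀ S → Dec (SpansArc S)
  spansArc? S = any? λ a → any? λ b → a ∈? S ×-dec b ∈? S ×-dec (arc D a b Bool.≟ true)

  -- In a clique spanning no arc all adjacencies are common out-neighbours,
  -- so all its vertices share the out-neighbour of any one of them.
  arc-free-clique⊆N⁻ : ∀ S → IsClique D S → ¬ SpansArc S →
                       ∀ {x w} → x ∈ S → Arc D x w → S ⊆ ClosedInN D w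
  arc-free-clique⊆N⁻ S clique arc-free {x} {w} x∈ xw {z} z∈ with z ≟ x
  ... | yes refl = ∈N⁻⁺ D (inj₂ xw)
  ... | no z≢x with proj₂ (clique z x z∈ x∈ z≢x)
  ...   | inj₁ zx                    = ⊥-elim (arc-free (z , x , z∈ , x∈ , zx))
  ...   | inj₂ (inj₁ xz)             = ⊥-elim (arc-free (x , z , x∈ , z∈ , xz))
  ...   | inj₂ (inj₂ (w′ , zw′ , xw′)) =
    ∈N⁻⁺ D (inj₂ (subst (Arc D z) (out-unique xw′ xw) zw′))

  HasDistinctPair : Subset (n D) → Set
  HasDistinctPair S = ∃ λ x → ∃ λ y → x ∈ S × y ∈ S × x ≢ y

  hasDistinctPair? : ∀ S → Dec (HasDistinctPair S)
  hasDistinctPair? S = any? λ x → any? λ y → x ∈? S ×-dec y ∈? S ×-dec ¬? (x ≟ y)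

  -- A subset without two distinct members is contained in a singleton
  -- (around its member, or around the given default vertex if it is empty).
  subsingleton-bound : ∀ S → ¬ HasDistinctPair S → V → ∃ λ x → ∀ {z} → z ∈ S → z ≡ x
  subsingleton-bound S no-pair default with nonempty? S
  ... | no empty = default , λ z∈ → ⊥-elim (empty (_ , z∈))
  ... | yes (x , x∈) = x , λ {z} z∈ → same z∈
    where
    same : ∀ {z} → z ∈ S → z ≡ x
    same {z} z∈ with z ≟ x
    ... | yes z≡x = z≡x
    ... | no z≢x  = ⊥-elim (no-pair (z , x , z∈ , x∈ , z≢x))

  clique⊆N⁻ : (∀ x → Covered D x) → V → ∀ S → IsClique D S →
              Σ V λ u → 1 ≤ indeg D u × S ⊆ ClosedInN D u
  clique⊆N⁻ covered default S clique with spansArc? S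
  ... | yes (a , b , a∈ , b∈ , ab) =
    b , arc⇒indeg≥1 D ab , clique-with-arc⊆N⁻ S clique ab a∈ b∈
  ... | no arc-free with hasDistinctPair? S
  ...   | yes (x , y , x∈ , y∈ , x≢y) with proj₂ (clique x y x∈ y∈ x≢y)
  ...     | inj₁ xy         = ⊥-elim (arc-free (x , y , x∈ , y∈ , xy))
  ...     | inj₂ (inj₁ yx)  = ⊥-elim (arc-free (y , x , y∈ , x∈ , yx))
  ...     | inj₂ (inj₂ (w , xw , _)) =
    w , arc⇒indeg≥1 D xw , arc-free-clique⊆N⁻ S clique arc-free x∈ xw
  clique⊆N⁻ covered default S clique | no _ | no no-pair
    with subsingleton-bound S no-pair default
  ... | x , S⊆⁅x⁆ with covered x
  ...   | u , indeg≥1 , x∈N⁻ =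
    u , indeg≥1 , λ z∈ → subst (_∈ ClosedInN D u) (sym (S⊆⁅x⁆ z∈)) x∈N⁻

  maximal-clique⇒N⁻ : (∀ x → Covered D x) → V → ∀ S → IsMaximalClique D S →
                      Σ V λ u → 1 ≤ indeg D u × S ≡ ClosedInN D u
  maximal-clique⇒N⁻ covered default S (clique , maximal)
    with clique⊆N⁻ covered default S clique
  ... | u , indeg≥1 , S⊆N⁻ =
    u , indeg≥1 , ⊆-antisym S⊆N⁻ (maximal _ (closedInN-clique D u) S⊆N⁻)

  -- If d⁻(u) ≥ 1 then N⁻[u] contains an arc w → u, so every clique
  -- containing N⁻[u] lies in N⁻[u]: it is a maximal clique.
  N⁻-maximal : ∀ u → 1 ≤ indeg D u → IsMaximalClique D (ClosedInN D u)
  N⁻-maximal u indeg≥1 with positive⇒member (InN D u) indeg≥1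
  ... | w , w∈InN = closedInN-clique D u , λ T clique N⁻⊆T →
    let wu = ∈-tabulate⁻ _ w w∈InN in
    clique-with-arc⊆N⁻ T clique wu (N⁻⊆T (∈N⁻⁺ D (inj₂ wu))) (N⁻⊆T (∈N⁻⁺ D (inj₁ refl)))

-- The maximal cliques of P(D) for a nontrivial weakly connected (i,1) digraph
-- are the N⁻[u] with d⁻(u) ≥ 1.

lemma2p4 : (i : ℕ) → 1 ≤ i → (D : Digraph) → Is-i1 D i → 2 ≤ n D → WeaklyConnected D →
    (S : Subset (n D)) →
    (IsMaximalClique D S → Σ (Fin (n D)) (λ u → 1 ≤ indeg D u × S ≡ ClosedInN D u))
    × (Σ (Fin (n D)) (λ u → 1 ≤ indeg D u × S ≡ ClosedInN D u) → IsMaximalClique D S)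
lemma2p4 _ _ D (acyclic , _ , outdeg≤1) two≤n wc S =
  maximal-clique⇒N⁻ covered default S ,
  λ { (u , indeg≥1 , refl) → N⁻-maximal u indeg≥1 }
  where
  open Functional D acyclic outdeg≤1

  covered : ∀ x → Covered D x
  covered = weakly-connected⇒covered D two≤n wc

  default : Fin (n D)
  default = some-element two≤n
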